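{- Let $r\ge 2$ and $n\ge 2r+1$ be integers. The odd girth (length of a shortest odd cycle) of $H_{n:r}$ is \[\max\left\{5,\ 2\left\lceil \frac{r}{n-2r}\right\rceil+1\right\}.\]
   Context: For positive integers $n,r$ write $[n]=\{1,\dots,n\}$. The Häggkvist–Hell graph $H_{n:r}$ is the graph whose vertices are the ordered pairs $(h,T)$ where $T$ is an $r$-element subset of $[n]$ and $h\in[n]\setminus T$; two vertices $(h_x,T_x)$ and $(h_y,T_y)$ are adjacent iff $h_x\in T_y$, $h_y\in T_x$ and $T_x\cap T_y=\varnothing$. -}

module Defs where

open import Data.Nat using (ℕ; zero; suc; _+_; _*_; _≤_; _⊔_)
open import Data.Nat.DivMod using (_/_)
open import Data.Fin using (Fin; toℕ)
open import Data.Fin.Subset using (Subset; _∈_; _∉_; _∩_; ∣_∣; ⊥)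
open import Data.Product using (Σ; _×_; _,_; proj₁; proj₂; ∃)
open import Data.Sum using (_⊎_)
open import Relation.Binary.PropositionalEquality using (_≡_)

-- Ground set [n] is modelled by Fin n (elements 0,…,n-1).
-- A vertex of H_{n:r}: a pair (h , T) with T an r-subset and h ∉ T.
Vertex : ℕ → ℕ → Set
Vertex n r = Σ (Fin n × Subset n) λ p → (∣ proj₂ p ∣ ≡ r) × (proj₁ p ∉ proj₂ p)

head : ∀ {n r} → Vertex n r → Fin n
head ((h , _) , _) = h

set : ∀ {n r} → Vertex n r → Subset n
set ((_ , T) , _) = T

Adj : ∀ {n r} → Vertex n r → Vertex n r → Set
Adj x y = (head x ∈ set y) × (head y ∈ set x) × (set x ∩ set y ≡ ⊥)

IsCycle : ∀ {n r} (k : ℕ) → (Fin k → Vertex n r) → Set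
IsCycle k c =
  (3 ≤ k)
  × (∀ i j → proj₁ (c i) ≡ proj₁ (c j) → i ≡ j)
  × (∀ i j → (suc (toℕ i) ≡ toℕ j ⊎ (suc (toℕ i) ≡ k × toℕ j ≡ 0)) → Adj (c i) (c j))

Odd : ℕ → Set
Odd k = ∃ λ m → k ≡ 2 * m + 1

OddGirth : ℕ → ℕ → ℕ → Set
OddGirth n r g =
  (Odd g × Σ (Fin g → Vertex n r) (IsCycle g))
  × (∀ k (c : Fin k → Vertex n r) → IsCycle k c → Odd k → g ≤ k)

-- Ceiling division ⌈ a / d ⌉ for d ≥ 1 (value for d = 0 is irrelevant, set to 0).
ceilDiv : ℕ → ℕ → ℕ
ceilDiv a zero = 0
ceilDiv a (suc d) = (a + d) / suc d

module Submission where

-- H_{n:r} has no triangle (the head of the middle vertex would lie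
-- in two disjoint sets).  Along any cycle, the sets S_i, S_{i+2} are both
-- disjoint from the r-set S_{i+1}, so |S_i ─ S_{i+2}| ≤ n - 2r = s; by the
-- triangle inequality for |A ─ B|, 2m steps change the set by at most m·s
-- elements.  In an odd cycle of length 2m+1 the sets S_0 and S_{2m} are
-- disjoint, so r ≤ m·s, i.e. m ≥ ⌈r/s⌉.
--
-- A staircase 0 = p_0 < p_1 < … < p_t = r with steps at most
-- e < r yields, inside [0, 2r+e), an odd cycle of length 2t+1 whose sets are
-- intervals [p_j, p_j + r) and complements of windows [p_j, p_j + e + r).
-- With e = s and t = ⌈r/s⌉ when s < r, and e = r-1, t = 2 otherwise, this
-- matches the lower bound.  Sets are handled as Boolean predicates on ℕ.

open import Data.Nat
open import Data.Nat.Properties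
open import Data.Nat.Tactic.RingSolver using (solve-∀)
open import Data.Nat.DivMod using (_%_; m<n*o⇒m/o<n; m≡m%n+[m/n]*n; m%n<n; m/n*n≤m)
open import Data.Bool using (Bool; true; false; _∧_; _∨_)
open import Data.Bool.Properties using (∧-zeroʳ; ∧-distribʳ-∨; ∧-comm; ∨-zeroʳ)
open import Data.Vec using (_∷_; []; tabulate)
open import Data.Vec.Properties using (lookup∘tabulate; lookup⇒[]=; []=⇒lookup; ∷-injectiveˡ; ∷-injectiveʳ)
open import Data.Fin using (Fin; toℕ; fromℕ<)
open import Data.Fin.Patterns using (0F; 1F; 2F)
open import Data.Fin.Properties using (toℕ-fromℕ<; toℕ-injective; toℕ<n)
open import Data.Fin.Subset using (Subset; _∩_; _∪_; _─_; ∣_∣; _∈_; ⊥; inside; outside)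
open import Data.Fin.Subset.Properties using (∣p∣≤∣x∷p∣; x∈p∩q⁺; ∉⊥; ∩-comm)
open import Data.Product using (Σ; _×_; _,_; proj₁; proj₂)
open import Data.Sum using (_⊎_; inj₁; inj₂)
open import Data.Empty using (⊥-elim) renaming (⊥ to Empty)
open import Function using (case_of_)
open import Relation.Nullary using (yes; no; contradiction)
open import Relation.Binary.Definitions using (tri<; tri≈; tri>)
open import Relation.Binary.PropositionalEquality
open import Defs

-- Difference sizes obey the triangle inequality: an element of A outside C
-- is either outside B, or inside B and outside C.
∣─∣-triangle : ∀ {n} (A B C : Subset n) → ∣ A ─ C ∣ ≤ ∣ A ─ B ∣ + ∣ B ─ C ∣
∣─∣-triangle []      []      []      = z≤n
∣─∣-triangle (a ∷ A) (b ∷ B) (c ∷ C) = step a b c (∣─∣-triangle A B C)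
  where
  x = ∣ A ─ C ∣
  y = ∣ A ─ B ∣
  z = ∣ B ─ C ∣
  step : ∀ a b c → x ≤ y + z →
         ∣ (a ∷ A) ─ (c ∷ C) ∣ ≤ ∣ (a ∷ A) ─ (b ∷ B) ∣ + ∣ (b ∷ B) ─ (c ∷ C) ∣
  step outside outside outside h = h
  step outside inside  outside h = ≤-trans h (+-monoʳ-≤ y (n≤1+n z))
  step outside outside inside  h = h
  step outside inside  inside  h = h
  step inside  outside outside h = s≤s h
  step inside  inside  outside h = ≤-trans (s≤s h) (≤-reflexive (sym (+-suc y z)))
  step inside  outside inside  h = ≤-trans h (n≤1+n (y + z))
  step inside  inside  inside  h = h

-- If B is disjoint from both A and C, then A ─ C, B and C are pairwise
-- disjoint subsets of [n], so their sizes add up to at most n.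
∣─∣-squeeze : ∀ {n} (A B C : Subset n) → A ∩ B ≡ ⊥ → B ∩ C ≡ ⊥ → ∣ A ─ C ∣ + ∣ B ∣ + ∣ C ∣ ≤ n
∣─∣-squeeze []      []      []      _   _   = z≤n
∣─∣-squeeze (a ∷ A) (b ∷ B) (c ∷ C) AB BC =
  step a b c (∷-injectiveˡ AB) (∷-injectiveˡ BC) (∣─∣-squeeze A B C (∷-injectiveʳ AB) (∷-injectiveʳ BC))
  where
  x = ∣ A ─ C ∣
  step : ∀ {n} a b c → a ∧ b ≡ false → b ∧ c ≡ false → x + ∣ B ∣ + ∣ C ∣ ≤ n →
         ∣ (a ∷ A) ─ (c ∷ C) ∣ + ∣ b ∷ B ∣ + ∣ c ∷ C ∣ ≤ suc n
  step outside outside outside _ _ h = m≤n⇒m≤1+n h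
  step inside  outside outside _ _ h = s≤s h
  step a       outside inside  _ _ h = ≤-trans (≤-reflexive (+-suc (x + ∣ B ∣) ∣ C ∣)) (s≤s h)
  step outside inside  outside _ _ h = ≤-trans (≤-reflexive (cong (_+ ∣ C ∣) (+-suc x ∣ B ∣))) (s≤s h)
  step inside  inside  _       () _
  step _       inside  inside  _ ()

∣─∣-disjoint : ∀ {n} (A B : Subset n) → A ∩ B ≡ ⊥ → ∣ A ─ B ∣ ≡ ∣ A ∣
∣─∣-disjoint []      []      _  = refl
∣─∣-disjoint (a ∷ A) (b ∷ B) AB = step a b (∷-injectiveˡ AB) (∣─∣-disjoint A B (∷-injectiveʳ AB))
  where
  step : ∀ a b → a ∧ b ≡ false → ∣ A ─ B ∣ ≡ ∣ A ∣ → ∣ (a ∷ A) ─ (b ∷ B) ∣ ≡ ∣ a ∷ A ∣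
  step outside outside _ h = h
  step outside inside  _ h = h
  step inside  outside _ h = cong suc h
  step inside  inside  () _

∈-disjoint : ∀ {n} {x : Fin n} {A B : Subset n} → x ∈ A → x ∈ B → A ∩ B ≡ ⊥ → Empty
∈-disjoint x∈A x∈B AB = ∉⊥ (subst (_ ∈_) AB (x∈p∩q⁺ (x∈A , x∈B)))

∣p─p∣≡0 : ∀ {n} (A : Subset n) → ∣ A ─ A ∣ ≡ 0
∣p─p∣≡0 []            = refl
∣p─p∣≡0 (outside ∷ A) = ∣p─p∣≡0 A
∣p─p∣≡0 (inside ∷ A)  = ∣p─p∣≡0 A

-- Doubling by recursion: the index 2j of the j-th even cycle vertex then
-- grows by two definitional successor steps.
double : ℕ → ℕ
double zero    = zero
double (suc j) = suc (suc (double j))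

double≡2* : ∀ j → double j ≡ 2 * j
double≡2* zero    = refl
double≡2* (suc j) = cong suc (trans (cong suc (double≡2* j)) (sym (+-suc j (j + 0))))

double-reflects-≤ : ∀ {a b} → double a ≤ double b → a ≤ b
double-reflects-≤ {zero}          _             = z≤n
double-reflects-≤ {suc a} {suc b} (s≤s (s≤s h)) = s≤s (double-reflects-≤ h)

double-mono-≤ : ∀ {a b} → a ≤ b → double a ≤ double b
double-mono-≤ z≤n     = z≤n
double-mono-≤ (s≤s h) = s≤s (s≤s (double-mono-≤ h))

double-reflects-< : ∀ {a b} → suc (double a) ≤ double b → a < b
double-reflects-< {zero}  {suc b} _             = z<s
double-reflects-< {suc a} {suc b} (s≤s (s≤s h)) = s≤s (double-reflects-< h)

-- H_{n:r} is triangle-free: the head of y would lie in the disjoint sets of x and z.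
no-triangle : ∀ {n r} {x y z : Vertex n r} → Adj x y → Adj y z → Adj z x → Empty
no-triangle (_ , y∈x , _) (y∈z , _ , _) (_ , _ , z∩x) = ∈-disjoint y∈z y∈x z∩x

odd-cycle≥5 : ∀ {n r k} {c : Fin k → Vertex n r} → Odd k → IsCycle k c → 5 ≤ k
odd-cycle≥5         (zero , refl)         (s≤s () , _)
odd-cycle≥5 {c = c} (suc zero , refl)     (_ , _ , edge) =
  ⊥-elim (no-triangle {x = c 0F} {c 1F} {c 2F}
           (edge 0F 1F (inj₁ refl)) (edge 1F 2F (inj₁ refl)) (edge 2F 0F (inj₂ (refl , refl))))
odd-cycle≥5         (suc (suc m) , refl) _ = +-monoˡ-≤ 1 (*-monoʳ-≤ 2 (s≤s (s≤s (z≤n {m}))))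

-- Two steps along the cycle
-- change the set by at most s elements, so 2j steps change it by at most j*s;
-- but the last vertex of an odd cycle of length 2m+1 is adjacent to the first,
-- so their sets are disjoint and differ by all r elements.  Hence r ≤ m*s.
module OddCycleBound {n r s : ℕ} (n≡2r+s : 2 * r + s ≡ n)
                     {k : ℕ} (c : Fin k → Vertex n r) (cycle : IsCycle k c) where

  S : (i : ℕ) → i < k → Subset n
  S i i<k = set (c (fromℕ< i<k))

  ∣S∣≡r : ∀ i (i<k : i < k) → ∣ S i i<k ∣ ≡ r
  ∣S∣≡r i i<k = proj₁ (proj₂ (c (fromℕ< i<k)))

  consecutive : ∀ i (i<k : i < k) (1+i<k : suc i < k) → S i i<k ∩ S (suc i) 1+i<k ≡ ⊥
  consecutive i i<k 1+i<k = proj₂ (proj₂ (proj₂ (proj₂ cycle) (fromℕ< i<k) (fromℕ< 1+i<k)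
    (inj₁ (trans (cong suc (toℕ-fromℕ< i<k)) (sym (toℕ-fromℕ< 1+i<k))))))

  -- S i and S (i+2) are both disjoint from S (i+1), which has r elements.
  two-steps : ∀ i (i<k : i < k) (1+i<k : suc i < k) (2+i<k : suc (suc i) < k) →
              ∣ S i i<k ─ S (suc (suc i)) 2+i<k ∣ ≤ s
  two-steps i i<k 1+i<k 2+i<k = +-cancelʳ-≤ (2 * r) d s (begin
    d + 2 * r
      ≡⟨ cong (d +_) (cong (r +_) (+-identityʳ r)) ⟩
    d + (r + r)
      ≡⟨ sym (+-assoc d r r) ⟩
    d + r + r
      ≡⟨ cong₂ (λ x y → d + x + y) (sym (∣S∣≡r _ 1+i<k)) (sym (∣S∣≡r _ 2+i<k)) ⟩
    d + ∣ S (suc i) 1+i<k ∣ + ∣ S (suc (suc i)) 2+i<k ∣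
      ≤⟨ ∣─∣-squeeze _ _ _ (consecutive i i<k 1+i<k) (consecutive (suc i) 1+i<k 2+i<k) ⟩
    n
      ≡⟨ trans (sym n≡2r+s) (+-comm (2 * r) s) ⟩
    s + 2 * r
      ∎)
    where
    open ≤-Reasoning
    d = ∣ S i i<k ─ S (suc (suc i)) 2+i<k ∣

  even-walk : (0<k : 0 < k) → ∀ j (2j<k : double j < k) → ∣ S 0 0<k ─ S (double j) 2j<k ∣ ≤ j * s
  even-walk 0<k zero    _     = ≤-reflexive (∣p─p∣≡0 (S 0 0<k))
  even-walk 0<k (suc j) 2j+2<k = begin
    ∣ S 0 0<k ─ S (double (suc j)) 2j+2<k ∣
      ≤⟨ ∣─∣-triangle (S 0 0<k) (S (double j) 2j<k) _ ⟩
    ∣ S 0 0<k ─ S (double j) 2j<k ∣ + ∣ S (double j) 2j<k ─ S (double (suc j)) 2j+2<k ∣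
      ≤⟨ +-mono-≤ (even-walk 0<k j 2j<k) (two-steps _ 2j<k 2j+1<k 2j+2<k) ⟩
    j * s + s
      ≡⟨ +-comm (j * s) s ⟩
    suc j * s
      ∎
    where
    open ≤-Reasoning
    2j+1<k : suc (double j) < k
    2j+1<k = <-trans (n<1+n _) 2j+2<k
    2j<k : double j < k
    2j<k = <-trans (n<1+n _) 2j+1<k

  -- The closing edge of an odd cycle of length 2m+1 makes S_0 and S_{2m}
  -- disjoint, so they differ by all r elements.
  r≤m*s : ∀ m → k ≡ 2 * m + 1 → r ≤ m * s
  r≤m*s m k≡2m+1 = begin
    r                                ≡⟨ sym (∣S∣≡r 0 0<k) ⟩
    ∣ S 0 0<k ∣                      ≡⟨ sym (∣─∣-disjoint _ _ (trans (∩-comm _ _) last∩first)) ⟩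
    ∣ S 0 0<k ─ S (double m) 2m<k ∣ ≤⟨ even-walk 0<k m 2m<k ⟩
    m * s                            ∎
    where
    open ≤-Reasoning
    k≡1+2m : suc (double m) ≡ k
    k≡1+2m = trans (cong suc (double≡2* m)) (trans (+-comm 1 (2 * m)) (sym k≡2m+1))
    0<k : 0 < k
    0<k = subst (0 <_) k≡1+2m z<s
    2m<k : double m < k
    2m<k = subst (double m <_) k≡1+2m (n<1+n _)
    last∩first : S (double m) 2m<k ∩ S 0 0<k ≡ ⊥
    last∩first = proj₂ (proj₂ (proj₂ (proj₂ cycle) (fromℕ< 2m<k) (fromℕ< 0<k)
      (inj₂ (trans (cong suc (toℕ-fromℕ< 2m<k)) k≡1+2m , toℕ-fromℕ< 0<k))))

fromPred : ∀ {n} → (ℕ → Bool) → Subset n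
fromPred f = tabulate (λ i → f (toℕ i))

∈-fromPred : ∀ {n} (f : ℕ → Bool) {x : Fin n} → f (toℕ x) ≡ true → x ∈ fromPred f
∈-fromPred f {x} fx = lookup⇒[]= x _ (trans (lookup∘tabulate (λ i → f (toℕ i)) x) fx)

∈-fromPred⁻ : ∀ {n} (f : ℕ → Bool) {x : Fin n} → x ∈ fromPred f → f (toℕ x) ≡ true
∈-fromPred⁻ f {x} x∈ = trans (sym (lookup∘tabulate (λ i → f (toℕ i)) x)) ([]=⇒lookup x∈)

record Disjoint (f g : ℕ → Bool) : Set where
  constructor disjoint
  field apart : ∀ x → f x ∧ g x ≡ false
open Disjoint

disjoint-sym : ∀ {f g} → Disjoint f g → Disjoint g f
disjoint-sym {f} {g} f∩g = disjoint λ x → trans (∧-comm (g x) (f x)) (apart f∩g x)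

disjoint-∨ : ∀ {f g h} → Disjoint f h → Disjoint g h → Disjoint (λ x → f x ∨ g x) h
disjoint-∨ {f} {g} {h} f∩h g∩h = disjoint λ x →
  trans (∧-distribʳ-∨ (h x) (f x) (g x)) (cong₂ _∨_ (apart f∩h x) (apart g∩h x))

fromPred-∩ : ∀ {n f g} → Disjoint f g → fromPred {n} f ∩ fromPred g ≡ ⊥
fromPred-∩ {zero}  f∩g = refl
fromPred-∩ {suc n} {f} {g} f∩g =
  cong₂ _∷_ (apart f∩g 0) (fromPred-∩ {n} {λ x → f (suc x)} {λ x → g (suc x)} (disjoint λ x → apart f∩g (suc x)))

fromPred-∪ : ∀ {n} (f g : ℕ → Bool) → fromPred {n} (λ x → f x ∨ g x) ≡ fromPred f ∪ fromPred g
fromPred-∪ {zero}  f g = refl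
fromPred-∪ {suc n} f g = cong ((f 0 ∨ g 0) ∷_) (fromPred-∪ {n} (λ x → f (suc x)) (λ x → g (suc x)))

∣∪∣-disjoint : ∀ {n} (A B : Subset n) → A ∩ B ≡ ⊥ → ∣ A ∪ B ∣ ≡ ∣ A ∣ + ∣ B ∣
∣∪∣-disjoint []      []      _  = refl
∣∪∣-disjoint (a ∷ A) (b ∷ B) AB = step a b (∷-injectiveˡ AB) (∣∪∣-disjoint A B (∷-injectiveʳ AB))
  where
  step : ∀ a b → a ∧ b ≡ false → ∣ A ∪ B ∣ ≡ ∣ A ∣ + ∣ B ∣ →
         ∣ (a ∷ A) ∪ (b ∷ B) ∣ ≡ ∣ a ∷ A ∣ + ∣ b ∷ B ∣
  step outside outside _ h = h
  step outside inside  _ h = trans (cong suc h) (sym (+-suc ∣ A ∣ ∣ B ∣))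
  step inside  outside _ h = cong suc h
  step inside  inside  () _

∣fromPred-∨∣ : ∀ {n f g} → Disjoint f g →
               ∣ fromPred {n} (λ x → f x ∨ g x) ∣ ≡ ∣ fromPred {n} f ∣ + ∣ fromPred {n} g ∣
∣fromPred-∨∣ {n} {f} {g} f∩g =
  trans (cong ∣_∣ (fromPred-∪ {n} f g)) (∣∪∣-disjoint (fromPred {n} f) (fromPred g) (fromPred-∩ f∩g))

-- The half-open interval [a, a + l) as a predicate, by recursion so that
-- shifting the ground set by one shifts the interval definitionally.
interval : ℕ → ℕ → ℕ → Bool
interval zero    zero    _       = false
interval zero    (suc l) zero    = true
interval zero    (suc l) (suc x) = interval zero l x
interval (suc a) l       zero    = false
interval (suc a) l       (suc x) = interval a l x

interval-∋ : ∀ {a x} l → a ≤ x → x < a + l → interval a l x ≡ true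
interval-∋ {zero}  {x}     zero    _        ()
interval-∋ {zero}  {zero}  (suc l) _        _        = refl
interval-∋ {zero}  {suc x} (suc l) _        (s≤s h)  = interval-∋ l z≤n h
interval-∋ {suc a} {suc x} l       (s≤s h₁) (s≤s h₂) = interval-∋ l h₁ h₂

interval-before : ∀ {a x} l → x < a → interval a l x ≡ false
interval-before {suc a} {zero}  l _       = refl
interval-before {suc a} {suc x} l (s≤s h) = interval-before l h

interval-beyond : ∀ a l {x} → a + l ≤ x → interval a l x ≡ false
interval-beyond zero    zero    {x}     _       = refl
interval-beyond zero    (suc l) {suc x} (s≤s h) = interval-beyond zero l h
interval-beyond (suc a) l       {zero}  _       = refl
interval-beyond (suc a) l       {suc x} (s≤s h) = interval-beyond a l h

interval-disjoint : ∀ a l {b} m → a + l ≤ b → Disjoint (interval a l) (interval b m)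
interval-disjoint a l {b} m a+l≤b = disjoint apart-at
  where
  apart-at : ∀ x → interval a l x ∧ interval b m x ≡ false
  apart-at x with x <? b
  ... | yes x<b = trans (cong (interval a l x ∧_) (interval-before m x<b)) (∧-zeroʳ _)
  ... | no  x≮b = cong (_∧ interval b m x) (interval-beyond a l (≤-trans a+l≤b (≮⇒≥ x≮b)))

∣interval∣ : ∀ n a l → a + l ≤ n → ∣ fromPred {n} (interval a l) ∣ ≡ l
∣interval∣ zero    zero    zero    _       = refl
∣interval∣ (suc n) zero    zero    _       = ∣interval∣ n zero zero z≤n
∣interval∣ (suc n) zero    (suc l) (s≤s h) = cong suc (∣interval∣ n zero l h)
∣interval∣ (suc n) (suc a) l       (s≤s h) = ∣interval∣ n a l h

record PredVertex (n r : ℕ) : Set where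
  field
    hd      : ℕ
    members : ℕ → Bool
    hd<n    : hd < n
    size    : ∣ fromPred {n} members ∣ ≡ r
    hd∉     : members hd ≡ false

  vertex : Vertex n r
  vertex = (fromℕ< hd<n , fromPred members) , size , λ hd∈ → case lemma hd∈ of λ ()
    where
    lemma : fromℕ< hd<n ∈ fromPred members → false ≡ true
    lemma hd∈ = trans (sym hd∉) (trans (cong members (sym (toℕ-fromℕ< hd<n))) (∈-fromPred⁻ members hd∈))

open PredVertex using (hd; members; vertex)

predAdj : ∀ {n r} (x y : PredVertex n r) →
          members y (hd x) ≡ true → members x (hd y) ≡ true → Disjoint (members x) (members y) →
          Adj (vertex x) (vertex y)
predAdj x y x∈y y∈x x∩y =
  ∈-fromPred (members y) (trans (cong (members y) (toℕ-fromℕ< (PredVertex.hd<n x))) x∈y) ,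
  ∈-fromPred (members x) (trans (cong (members x) (toℕ-fromℕ< (PredVertex.hd<n y))) y∈x) ,
  fromPred-∩ x∩y

record Staircase (r e t : ℕ) : Set where
  field
    height   : ℕ → ℕ
    starts   : height 0 ≡ 0
    ends     : height t ≡ r
    capped   : ∀ j → height j ≤ r
    monotone : ∀ j → height j ≤ height (suc j)
    rising   : ∀ j → j < t → height j < height (suc j)
    short    : ∀ j → height (suc j) ≤ height j + e

  height-strict : ∀ {a b} → a < b → b ≤ t → height a < height b
  height-strict {a} {suc b} (s≤s a≤b) 1+b≤t with m≤n⇒m<n∨m≡n a≤b
  ... | inj₁ a<b  = <-trans (height-strict a<b (<⇒≤ 1+b≤t)) (rising b 1+b≤t)
  ... | inj₂ refl = rising a 1+b≤t

  height-injective : ∀ {a b} → a ≤ t → b ≤ t → height a ≡ height b → a ≡ b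
  height-injective {a} {b} a≤t b≤t eq with <-cmp a b
  ... | tri< a<b _ _ = ⊥-elim (<-irrefl eq (height-strict a<b b≤t))
  ... | tri≈ _ a≡b _ = a≡b
  ... | tri> _ _ b<a = ⊥-elim (<-irrefl (sym eq) (height-strict b<a a≤t))

  step>0 : ∀ {j} → j < t → 0 < e
  step>0 {j} j<t = +-cancelˡ-< (height j) 0 e
    (<-≤-trans (subst (_< height (suc j)) (sym (+-identityʳ (height j))) (rising j j<t)) (short j))

  below-top : ∀ {j} → j < t → height j < r
  below-top j<t = subst (_ <_) ends (height-strict j<t ≤-refl)

  at-top : ∀ {j} → j ≤ t → r ≤ height j → j ≡ t
  at-top {j} j≤t r≤hj with m≤n⇒m<n∨m≡n j≤t
  ... | inj₁ j<t  = ⊥-elim (<⇒≱ (below-top j<t) r≤hj)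
  ... | inj₂ j≡t = j≡t

-- The odd cycle of length 2t+1 built from a staircase p.  Everything happens
-- inside [0, N) ⊆ [n] with N = 2r + e.  The even vertex E_j has set
-- [p_j, p_j + r); the odd vertex O_j has as set the complement in [0, N) of
-- the window [p_j, p_j + e + r), which contains both E_j and E_{j+1}.  The
-- cycle is E_0 O_0 E_1 O_1 … O_{t-1} E_t, closed by E_t = [r, 2r) ~ E_0 = [0, r).
module StaircaseCycle {n r e t : ℕ} (e<r : e < r) (N≤n : 2 * r + e ≤ n) (P : Staircase r e t) where
  open Staircase P renaming (height to p)

  N : ℕ
  N = 2 * r + e

  0<r : 0 < r
  0<r = ≤-<-trans z≤n e<r

  r+r≤N : r + r ≤ N
  r+r≤N = ≤-trans (≤-reflexive (cong (r +_) (sym (+-identityʳ r)))) (m≤m+n (2 * r) e)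

  r<N : r < N
  r<N = <-≤-trans (m<m+n r 0<r) r+r≤N

  r<n : r < n
  r<n = <-≤-trans r<N N≤n

  past-window<N : ∀ {x} → x < r → x + e + r < N
  past-window<N {x} x<r = begin-strict
    x + e + r ≡⟨ cong (_+ r) (+-comm x e) ⟩
    e + x + r <⟨ +-monoˡ-< r (+-monoʳ-< e x<r) ⟩
    e + r + r ≡⟨ rearrange e r ⟩
    N         ∎
    where
    open ≤-Reasoning
    rearrange : ∀ e r → e + r + r ≡ 2 * r + e
    rearrange = solve-∀

  -- The part of [0, N) after O_j's window has exactly r - p_j elements.
  window-end : ∀ j → p j + e + r + (r ∸ p j) ≡ N
  window-end j = begin
    p j + e + r + (r ∸ p j)   ≡⟨ rearrange (p j) e r (r ∸ p j) ⟩
    (p j + (r ∸ p j)) + r + e ≡⟨ cong (λ x → x + r + e) (m+[n∸m]≡n (capped j)) ⟩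
    r + r + e                 ≡⟨ cong (λ x → r + x + e) (sym (+-identityʳ r)) ⟩
    N                         ∎
    where
    open ≡-Reasoning
    rearrange : ∀ a e r d → a + e + r + d ≡ (a + d) + r + e
    rearrange = solve-∀

  evenSet : ℕ → ℕ → Bool
  evenSet j = interval (p j) r

  oddSet : ℕ → ℕ → Bool
  oddSet j x = interval 0 (p j) x ∨ interval (p j + e + r) (r ∸ p j) x

  evenSet-∋ : ∀ {j x} → p j ≤ x → x < p j + r → evenSet j x ≡ true
  evenSet-∋ = interval-∋ r

  oddSet-∋ˡ : ∀ {j x} → x < p j → oddSet j x ≡ true
  oddSet-∋ˡ {j} {x} x<pj = cong (_∨ interval (p j + e + r) (r ∸ p j) x) (interval-∋ (p j) z≤n x<pj)

  oddSet-∋ʳ : ∀ {j x} → p j + e + r ≤ x → x < N → oddSet j x ≡ true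
  oddSet-∋ʳ {j} {x} after x<N =
    trans (cong (interval 0 (p j) x ∨_) (interval-∋ (r ∸ p j) after (subst (x <_) (sym (window-end j)) x<N)))
          (∨-zeroʳ _)

  odd-even-disjoint : ∀ j k → p j ≤ p k → p k ≤ p j + e → Disjoint (oddSet j) (evenSet k)
  odd-even-disjoint j k pj≤pk pk≤pj+e = disjoint-∨
    (interval-disjoint 0 (p j) r pj≤pk)
    (disjoint-sym (interval-disjoint (p k) r (r ∸ p j) (+-monoˡ-≤ r pk≤pj+e)))

  ∣evenSet∣ : ∀ j → ∣ fromPred {n} (evenSet j) ∣ ≡ r
  ∣evenSet∣ j = ∣interval∣ n (p j) r (≤-trans (+-monoˡ-≤ r (capped j)) (≤-trans r+r≤N N≤n))

  -- E_j's head sits just past O_j's window, i.e. at p_j + e + r, unless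
  -- that falls outside [0, N) (at the top, p_j = r): then it is 0.
  evenHead : ℕ → ℕ
  evenHead j with p j <? r
  ... | yes _ = p j + e + r
  ... | no  _ = 0

  -- O_j's head p_{j+1} lies in both E_j and E_{j+1}.
  oddHead : ℕ → ℕ
  oddHead j = p (suc j)

  ∣oddSet∣ : ∀ j → ∣ fromPred {n} (oddSet j) ∣ ≡ r
  ∣oddSet∣ j = begin
    ∣ fromPred {n} (oddSet j) ∣
      ≡⟨ ∣fromPred-∨∣ {n} (interval-disjoint 0 (p j) (r ∸ p j) (≤-trans (m≤m+n (p j) e) (m≤m+n _ r))) ⟩
    ∣ fromPred {n} (interval 0 (p j)) ∣ + ∣ fromPred {n} (interval (p j + e + r) (r ∸ p j)) ∣
      ≡⟨ cong₂ _+_ (∣interval∣ n 0 (p j) (≤-trans (capped j) (<⇒≤ r<n)))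
                   (∣interval∣ n (p j + e + r) (r ∸ p j) (≤-trans (≤-reflexive (window-end j)) N≤n)) ⟩
    p j + (r ∸ p j)
      ≡⟨ m+[n∸m]≡n (capped j) ⟩
    r ∎
    where open ≡-Reasoning

  evenHead<n : ∀ j → evenHead j < n
  evenHead<n j with p j <? r
  ... | yes pj<r = <-≤-trans (past-window<N pj<r) N≤n
  ... | no  _    = ≤-<-trans z≤n r<n

  oddHead<n : ∀ j → oddHead j < n
  oddHead<n j = ≤-<-trans (capped (suc j)) r<n

  evenHead∉ : ∀ j → evenSet j (evenHead j) ≡ false
  evenHead∉ j with p j <? r
  ... | yes _    = interval-beyond (p j) r (+-monoˡ-≤ r (m≤m+n (p j) e))
  ... | no  pj≮r = interval-before r (<-≤-trans 0<r (≮⇒≥ pj≮r))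

  oddHead∉ : ∀ j → oddSet j (oddHead j) ≡ false
  oddHead∉ j = cong₂ _∨_ (interval-beyond 0 (p j) (monotone j))
                         (interval-before (r ∸ p j) (≤-<-trans (short j) (m<m+n (p j + e) 0<r)))

  E : ℕ → PredVertex n r
  E j = record
    { hd = evenHead j ; members = evenSet j ; hd<n = evenHead<n j ; size = ∣evenSet∣ j ; hd∉ = evenHead∉ j }

  O : ℕ → PredVertex n r
  O j = record
    { hd = oddHead j ; members = oddSet j ; hd<n = oddHead<n j ; size = ∣oddSet∣ j ; hd∉ = oddHead∉ j }

  E-O : ∀ j → j < t → Adj (vertex (E j)) (vertex (O j))
  E-O j j<t = predAdj (E j) (O j) head-in-O
                (evenSet-∋ (monotone j) (≤-<-trans (short j) (+-monoʳ-< (p j) e<r)))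
                (disjoint-sym (odd-even-disjoint j j ≤-refl (m≤m+n (p j) e)))
    where
    head-in-O : oddSet j (evenHead j) ≡ true
    head-in-O with p j <? r
    ... | yes pj<r = oddSet-∋ʳ ≤-refl (past-window<N pj<r)
    ... | no  pj≮r = ⊥-elim (pj≮r (below-top j<t))

  O-E : ∀ j → Adj (vertex (O j)) (vertex (E (suc j)))
  O-E j = predAdj (O j) (E (suc j)) (evenSet-∋ ≤-refl (m<m+n (p (suc j)) 0<r)) head-in-O
                  (odd-even-disjoint j (suc j) (monotone j) (short j))
    where
    -- At the top the head 0 lies before O_j's window, since p_j ≥ r - e > 0.
    head-in-O : oddSet j (evenHead (suc j)) ≡ true
    head-in-O with p (suc j) <? r
    ... | yes h = oddSet-∋ʳ (+-monoˡ-≤ r (+-monoˡ-≤ e (monotone j))) (past-window<N h)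
    ... | no  h = oddSet-∋ˡ (+-cancelʳ-< e 0 (p j) (<-≤-trans e<r (≤-trans (≮⇒≥ h) (short j))))

  E-E : Adj (vertex (E t)) (vertex (E 0))
  E-E = predAdj (E t) (E 0) top-head-in-E₀ bottom-head-in-Eₜ
                (disjoint-sym (interval-disjoint (p 0) r r (≤-reflexive (trans (cong (_+ r) starts) (sym ends)))))
    where
    top-head-in-E₀ : evenSet 0 (evenHead t) ≡ true
    top-head-in-E₀ with p t <? r
    ... | yes pt<r = ⊥-elim (<-irrefl ends pt<r)
    ... | no  _    = evenSet-∋ (≤-reflexive starts) (≤-trans 0<r (m≤n+m r (p 0)))
    bottom-head-in-Eₜ : evenSet t (evenHead 0) ≡ true
    bottom-head-in-Eₜ with p 0 <? r
    ... | yes _    = evenSet-∋ (subst (_≤ p 0 + e + r) (sym ends) (m≤n+m r (p 0 + e)))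
                       (subst₂ _<_ (cong (λ x → x + e + r) (sym starts)) (cong (_+ r) (sym ends)) (+-monoˡ-< r e<r))
    ... | no  p0≮r = ⊥-elim (p0≮r (subst (_< r) (sym starts) 0<r))

  data Slot : Set where
    even odd : ℕ → Slot

  next : Slot → Slot
  next (even j) = odd j
  next (odd j)  = even (suc j)

  slot : ℕ → Slot
  slot zero    = even 0
  slot (suc i) = next (slot i)

  index : Slot → ℕ
  index (even j) = double j
  index (odd j)  = suc (double j)

  index-next : ∀ s → index (next s) ≡ suc (index s)
  index-next (even j) = refl
  index-next (odd j)  = refl

  index-slot : ∀ i → index (slot i) ≡ i
  index-slot zero    = refl
  index-slot (suc i) = trans (index-next (slot i)) (cong suc (index-slot i))

  slot-double : ∀ j → slot (double j) ≡ even j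
  slot-double zero    = refl
  slot-double (suc j) = cong (λ s → next (next s)) (slot-double j)

  K : ℕ
  K = suc (double t)

  Valid : Slot → Set
  Valid (even j) = j ≤ t
  Valid (odd j)  = j < t

  valid : ∀ s → index s < K → Valid s
  valid (even j) (s≤s 2j≤2t)   = double-reflects-≤ 2j≤2t
  valid (odd j)  (s≤s 2j+1≤2t) = double-reflects-< 2j+1≤2t

  W : Slot → PredVertex n r
  W (even j) = E j
  W (odd j)  = O j

  edge : ∀ s → Valid (next s) → Adj (vertex (W s)) (vertex (W (next s)))
  edge (even j) j<t = E-O j j<t
  edge (odd j)  _   = O-E j

  -- Heads of valid slots are distinct: odd heads lie in [1, r], even heads
  -- below the top in [r + e, N), and the top head is 0.
  odd≢even : ∀ {j} j' → j < t → oddHead j ≢ evenHead j'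
  odd≢even {j} j' j<t eq with p j' <? r
  ... | yes _ = <-irrefl eq (≤-<-trans (capped (suc j)) (m<n+m r (<-≤-trans (step>0 j<t) (m≤n+m e (p j')))))
  ... | no  _ = <-irrefl (sym eq) (≤-<-trans z≤n (rising j j<t))

  past-window≢0 : ∀ x → x + e + r ≢ 0
  past-window≢0 x eq = <-irrefl (sym eq) (<-≤-trans 0<r (m≤n+m r (x + e)))

  evenHead-injective : ∀ {j j'} → j ≤ t → j' ≤ t → evenHead j ≡ evenHead j' → j ≡ j'
  evenHead-injective {j} {j'} j≤t j'≤t eq with p j <? r | p j' <? r
  ... | yes _ | yes _ = height-injective j≤t j'≤t (+-cancelʳ-≡ e _ _ (+-cancelʳ-≡ r _ _ eq))
  ... | yes _ | no  _ = ⊥-elim (past-window≢0 (p j) eq)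
  ... | no  _ | yes _ = ⊥-elim (past-window≢0 (p j') (sym eq))
  ... | no  h | no  h' = trans (at-top j≤t (≮⇒≥ h)) (sym (at-top j'≤t (≮⇒≥ h')))

  slot-injective : ∀ {s s'} → Valid s → Valid s' → hd (W s) ≡ hd (W s') → s ≡ s'
  slot-injective {even j} {even j'} j≤t  j'≤t eq = cong even (evenHead-injective j≤t j'≤t eq)
  slot-injective {odd j}  {odd j'}  j<t  j'<t eq = cong odd (suc-injective (height-injective j<t j'<t eq))
  slot-injective {odd j}  {even j'} j<t  _    eq = ⊥-elim (odd≢even j' j<t eq)
  slot-injective {even j} {odd j'}  _    j'<t eq = ⊥-elim (odd≢even j j'<t (sym eq))

  1≤t : 1 ≤ t
  1≤t = n≢0⇒n>0 λ t≡0 → <-irrefl (trans (sym starts) (trans (cong p (sym t≡0)) ends)) 0<r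

  cycle-of-length-K : Σ (Fin K → Vertex n r) (IsCycle K)
  cycle-of-length-K = c , s≤s (double-mono-≤ 1≤t) , distinct , adjacent
    where
    c : Fin K → Vertex n r
    c x = vertex (W (slot (toℕ x)))

    valid-at : ∀ x → Valid (slot (toℕ x))
    valid-at x = valid (slot (toℕ x)) (subst (_< K) (sym (index-slot (toℕ x))) (toℕ<n x))

    head-of : ∀ x → toℕ (proj₁ (proj₁ (c x))) ≡ hd (W (slot (toℕ x)))
    head-of x = toℕ-fromℕ< (PredVertex.hd<n (W (slot (toℕ x))))

    distinct : ∀ x y → proj₁ (c x) ≡ proj₁ (c y) → x ≡ y
    distinct x y eq = toℕ-injective (begin
      toℕ x                 ≡⟨ sym (index-slot (toℕ x)) ⟩
      index (slot (toℕ x))  ≡⟨ cong index (slot-injective (valid-at x) (valid-at y) same-head) ⟩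
      index (slot (toℕ y))  ≡⟨ index-slot (toℕ y) ⟩
      toℕ y                 ∎)
      where
      open ≡-Reasoning
      same-head : hd (W (slot (toℕ x))) ≡ hd (W (slot (toℕ y)))
      same-head = trans (sym (head-of x)) (trans (cong (λ v → toℕ (proj₁ v)) eq) (head-of y))

    adjacent : ∀ x y → (suc (toℕ x) ≡ toℕ y ⊎ (suc (toℕ x) ≡ K × toℕ y ≡ 0)) → Adj (c x) (c y)
    adjacent x y (inj₁ 1+x≡y) =
      subst (λ i → Adj (c x) (vertex (W (slot i)))) 1+x≡y (edge s (valid (next s) index-next-s<K))
      where
      s = slot (toℕ x)
      index-next-s<K : index (next s) < K
      index-next-s<K = subst (_< K) (sym (trans (index-next s) (trans (cong suc (index-slot (toℕ x))) 1+x≡y))) (toℕ<n y)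
    adjacent x y (inj₂ (1+x≡K , y≡0)) =
      subst₂ (λ i i' → Adj (vertex (W (slot i))) (vertex (W (slot i')))) (sym (suc-injective 1+x≡K)) (sym y≡0)
        (subst (λ s → Adj (vertex (W s)) (vertex (E 0))) (sym (slot-double t)) E-E)

  odd-cycle : Σ (Fin (2 * t + 1) → Vertex n r) (IsCycle (2 * t + 1))
  odd-cycle = subst (λ k → Σ (Fin k → Vertex n r) (IsCycle k)) K≡2t+1 cycle-of-length-K
    where
    K≡2t+1 : K ≡ 2 * t + 1
    K≡2t+1 = trans (cong suc (double≡2* t)) (+-comm 1 (2 * t))

linear-staircase : ∀ {r e t} → 0 < e → r ≤ t * e → t * e < r + e → Staircase r e t
linear-staircase {r} {e} {t} 0<e r≤te te<r+e = record
  { height   = λ j → j * e ⊓ r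
  ; starts   = refl
  ; ends     = m≥n⇒m⊓n≡n r≤te
  ; capped   = λ j → m⊓n≤n (j * e) r
  ; monotone = λ j → ⊓-monoˡ-≤ r (m≤n+m (j * e) e)
  ; rising   = rising
  ; short    = short
  }
  where
  rising : ∀ j → j < t → j * e ⊓ r < suc j * e ⊓ r
  rising j j<t = begin-strict
    j * e ⊓ r     ≡⟨ m≤n⇒m⊓n≡m (<⇒≤ je<r) ⟩
    j * e         <⟨ ⊓-pres-m< (m<n+m (j * e) 0<e) je<r ⟩
    suc j * e ⊓ r ∎
    where
    open ≤-Reasoning
    je<r : j * e < r
    je<r = +-cancelʳ-< e (j * e) r (≤-<-trans (≤-trans (≤-reflexive (+-comm (j * e) e)) (*-monoˡ-≤ e j<t)) te<r+e)

  short : ∀ j → suc j * e ⊓ r ≤ j * e ⊓ r + e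
  short j = begin
    (e + j * e) ⊓ r       ≤⟨ ⊓-monoʳ-≤ (e + j * e) (m≤m+n r e) ⟩
    (e + j * e) ⊓ (r + e) ≡⟨ cong (_⊓ (r + e)) (+-comm e (j * e)) ⟩
    (j * e + e) ⊓ (r + e) ≡⟨ sym (+-distribʳ-⊓ e (j * e) r) ⟩
    j * e ⊓ r + e         ∎
    where open ≤-Reasoning

module _ (r s : ℕ) where
  private
    d = suc s
    c = ceilDiv r d

  ceilDiv-least : ∀ m → r ≤ m * d → c ≤ m
  ceilDiv-least m r≤md =
    ≤-pred (m<n*o⇒m/o<n {r + s} {suc m} {d} (s≤s (subst (_≤ s + m * d) (+-comm s r) (+-monoʳ-≤ s r≤md))))

  ceilDiv-covers : r ≤ c * d
  ceilDiv-covers = +-cancelʳ-≤ s r (c * d) (begin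
    r + s                  ≡⟨ m≡m%n+[m/n]*n (r + s) d ⟩
    (r + s) % d + c * d    ≤⟨ +-monoˡ-≤ (c * d) (≤-pred (m%n<n (r + s) d)) ⟩
    s + c * d              ≡⟨ +-comm s (c * d) ⟩
    c * d + s              ∎)
    where open ≤-Reasoning

  ceilDiv-tight : c * d < r + d
  ceilDiv-tight = begin-strict
    c * d                  ≤⟨ m/n*n≤m (r + s) d ⟩
    r + s                  <⟨ +-monoʳ-< r (n<1+n s) ⟩
    r + d                  ∎
    where open ≤-Reasoning

module _ {n r s : ℕ} (n≡2r+s+1 : 2 * r + suc s ≡ n) where
  private
    g = 5 ⊔ (2 * ceilDiv r (suc s) + 1)

  odd-girth-lower : ∀ k (c : Fin k → Vertex n r) → IsCycle k c → Odd k → g ≤ k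
  odd-girth-lower k c cycle (m , k≡2m+1) = ⊔-lub (odd-cycle≥5 {c = c} (m , k≡2m+1) cycle) (begin
    2 * ceilDiv r (suc s) + 1 ≤⟨ +-monoˡ-≤ 1 (*-monoʳ-≤ 2 (ceilDiv-least r s m r≤ms)) ⟩
    2 * m + 1                 ≡⟨ sym k≡2m+1 ⟩
    k                         ∎)
    where
    open ≤-Reasoning
    r≤ms : r ≤ m * suc s
    r≤ms = OddCycleBound.r≤m*s n≡2r+s+1 c cycle m k≡2m+1

  -- An odd cycle of length g exists: from the staircase with step s + 1 when
  -- s + 1 < r, and with step r - 1 and two steps (a 5-cycle) otherwise.
  odd-girth-upper : 2 ≤ r → Σ (Fin g → Vertex n r) (IsCycle g)
  odd-girth-upper 2≤r with suc s <? r
  ... | yes s+1<r = subst (λ k → Σ (Fin k → Vertex n r) (IsCycle k)) (sym g≡2c+1) cycle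
    where
    c = ceilDiv r (suc s)
    cycle : Σ (Fin (2 * c + 1) → Vertex n r) (IsCycle (2 * c + 1))
    cycle = StaircaseCycle.odd-cycle s+1<r (≤-reflexive n≡2r+s+1)
              (linear-staircase {t = c} z<s (ceilDiv-covers r s) (ceilDiv-tight r s))
    g≡2c+1 : g ≡ 2 * c + 1
    g≡2c+1 = m≤n⇒m⊔n≡n (odd-cycle≥5 {c = proj₁ cycle} (c , refl) (proj₂ cycle))
  ... | no  s+1≮r = subst (λ k → Σ (Fin k → Vertex n r) (IsCycle k)) (sym g≡5) (five-cycle 2≤r)
    where
    r≤s+1 : r ≤ suc s
    r≤s+1 = ≮⇒≥ s+1≮r
    c≤1 : ceilDiv r (suc s) ≤ 1
    c≤1 = ceilDiv-least r s 1 (subst (r ≤_) (sym (*-identityˡ (suc s))) r≤s+1)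
    g≡5 : g ≡ 5
    g≡5 = m≥n⇒m⊔n≡m (≤-trans (+-monoˡ-≤ 1 (*-monoʳ-≤ 2 c≤1)) (m≤m+n 3 2))
    five-cycle : 2 ≤ r → Σ (Fin 5 → Vertex n r) (IsCycle 5)
    five-cycle (s≤s {n = e} 1≤e) = StaircaseCycle.odd-cycle ≤-refl room (linear-staircase {t = 2} 1≤e r≤2e 2e<r+e)
      where
      e+e≡2e : e + e ≡ 2 * e
      e+e≡2e = cong (e +_) (sym (+-identityʳ e))
      r≤2e : suc e ≤ 2 * e
      r≤2e = subst (suc e ≤_) e+e≡2e (+-monoˡ-≤ e 1≤e)
      2e<r+e : 2 * e < suc e + e
      2e<r+e = subst (_< suc (e + e)) e+e≡2e ≤-refl
      room : 2 * suc e + e ≤ n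
      room = subst (2 * suc e + e ≤_) n≡2r+s+1 (+-monoʳ-≤ (2 * suc e) (≤-trans (n≤1+n e) r≤s+1))

  odd-girth : 2 ≤ r → OddGirth n r g
  odd-girth 2≤r = (g-odd , odd-girth-upper 2≤r) , odd-girth-lower
    where
    g-odd : Odd g
    g-odd with ⊔-sel 5 (2 * ceilDiv r (suc s) + 1)
    ... | inj₁ g≡5    = 2 , g≡5
    ... | inj₂ g≡2c+1 = ceilDiv r (suc s) , g≡2c+1

mainTheorem2 : (r n : ℕ) → 2 ≤ r → 2 * r + 1 ≤ n →
    OddGirth n r (5 ⊔ (2 * ceilDiv r (n ∸ 2 * r) + 1))
mainTheorem2 r n 2≤r 2r+1≤n with n ∸ 2 * r | m+[n∸m]≡n (≤-trans (m≤m+n (2 * r) 1) 2r+1≤n)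
... | zero  | n≡2r+0 = contradiction (+-cancelˡ-≤ (2 * r) 1 0 (subst (2 * r + 1 ≤_) (sym n≡2r+0) 2r+1≤n)) λ ()
... | suc s | n≡2r+s = odd-girth n≡2r+s 2≤r
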